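{- In the system $ALFA_{Io}+\{I_{\vee p}\}$, the inverse of $E_p$ is derivable: for all graphs $A,B$, $[A[B]]\vdash\langle A\Rightarrow B\rangle$.
   Context: Graphs: the empty graph $\emptyset$ and propositional letters are graphs; if $G,H$ are graphs then so are the juxtaposition $GH$, the cut $[G]$ ($G$ inside a solid closed curve), the implication graph $\langle G\Rightarrow H\rangle$ (a solid closed curve containing $G$ and a dotted closed curve containing $H$), and the disjunction graph $\langle G\vee H\rangle$ (a solid closed curve containing two semi-dotted closed curves, one containing $G$ and one containing $H$; $\langle G\vee H\rangle=\langle H\vee G\rangle$). Juxtaposition is associative and commutative with unit $\emptyset$; $[\,]$ is the empty cut. Rules are schemata with $A,B,C$ arbitrary (possibly empty) graphs, applied to the whole graph on the sheet. The system $ALFA_{Io}$ has first-degree rules $MP_i: A\langle A\Rightarrow B\rangle\vdash B$; $I_\vee: A\vdash\langle A\vee B\rangle$; $R_2: AB\vdash A$; $I_{p3}:\langle A\vee B\rangle\vdash\langle[A]\Rightarrow B\rangle$; $I_{p2}: [AB]\vdash\langle A\Rightarrow[B]\rangle$; $E_p:\langle A\Rightarrow B\rangle\vdash[A[B]]$; and second-degree rules $R_{8i}$: if $AB\vdash C$ then $A\vdash\langle B\Rightarrow C\rangle$; $R_0$: if $A\vdash B$ and $A\vdash C$ then $A\vdash BC$; $E_\vee$: if $A\vdash C$ and $B\vdash C$ then $\langle A\vee B\rangle\vdash C$. The system $ALFA_{Io}+\{I_{\vee p}\}$ is $ALFA_{Io}$ with the additional first-degree rule $I_{\vee p}: [[A][B]]\vdash\langle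 A\vee B\rangle$. Derivability in a system is the least transitive relation on graphs containing all instances of its first-degree rules and closed under its second-degree rules. -}

module Defs where

open import Data.Nat using (ℕ)

data Graph : Set where
  ∅     : Graph
  letter : ℕ → Graph
  _·_   : Graph → Graph → Graph     -- juxtaposition  G H
  cut   : Graph → Graph             -- [ G ]
  _⇒g_  : Graph → Graph → Graph
  _∨g_  : Graph → Graph → Graph

infixr 6 _·_

data _≈_ : Graph → Graph → Set where
  ≈-refl  : ∀ {G} → G ≈ G
  ≈-sym   : ∀ {G H} → G ≈ H → H ≈ G
  ≈-trans : ∀ {G H K} → G ≈ H → H ≈ K → G ≈ K
  ·-assoc : ∀ {G H K} → ((G · H) · K) ≈ (G · (H · K))
  ·-comm  : ∀ {G H} → (G · H) ≈ (H · G)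
  ·-unitˡ : ∀ {G} → (∅ · G) ≈ G
  ∨-comm  : ∀ {G H} → (G ∨g H) ≈ (H ∨g G)
  ·-cong  : ∀ {G G' H H'} → G ≈ G' → H ≈ H' → (G · H) ≈ (G' · H')
  cut-cong : ∀ {G G'} → G ≈ G' → cut G ≈ cut G'
  ⇒-cong  : ∀ {G G' H H'} → G ≈ G' → H ≈ H' → (G ⇒g H) ≈ (G' ⇒g H')
  ∨-cong  : ∀ {G G' H H'} → G ≈ G' → H ≈ H' → (G ∨g H) ≈ (G' ∨g H')

-- Derivability in ALFA_Io + {I_∨p}: least transitive relation containing
-- all instances of the first-degree rules, closed under the second-degree
-- rules (and respecting the identification ≈ of graphs).
infix 4 _⊢_
data _⊢_ : Graph → Graph → Set where
  MPᵢ  : ∀ {A B} → (A · (A ⇒g B)) ⊢ B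
  I∨   : ∀ {A B} → A ⊢ (A ∨g B)
  R₂   : ∀ {A B} → (A · B) ⊢ A
  Ip3  : ∀ {A B} → (A ∨g B) ⊢ (cut A ⇒g B)
  Ip2  : ∀ {A B} → cut (A · B) ⊢ (A ⇒g cut B)
  Ep   : ∀ {A B} → (A ⇒g B) ⊢ cut (A · cut B)
  -- additional first-degree rule
  I∨p  : ∀ {A B} → cut (cut A · cut B) ⊢ (A ∨g B)
  R8ᵢ  : ∀ {A B C} → (A · B) ⊢ C → A ⊢ (B ⇒g C)
  R₀   : ∀ {A B C} → A ⊢ B → A ⊢ C → A ⊢ (B · C)
  E∨   : ∀ {A B C} → A ⊢ C → B ⊢ C → (A ∨g B) ⊢ C
  ⊢-trans : ∀ {A B C} → A ⊢ B → B ⊢ C → A ⊢ C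
  ⊢-resp  : ∀ {A A' B B'} → A ≈ A' → B ≈ B' → A ⊢ B → A' ⊢ B'

-- I_∨p turns the E_p-image [[B][[B]]] of ⟨[B] ⇒ [B]⟩ into excluded middle ⟨B ∨ [B]⟩.
-- Under hypotheses [A[B]] and A, argue by cases on it: B is immediate, while [B]
-- contradicts [[B]], which I_p2 and modus ponens extract from [A[B]] and A;
-- ex falso is available through I_∨ followed by I_p3.
module Submission where

open import Defs

⊢-refl : ∀ {A} → A ⊢ A
⊢-refl = ⊢-resp (≈-trans ·-comm ·-unitˡ) ≈-refl R₂

⊢-proj₁ : ∀ {A B} → (A · B) ⊢ A
⊢-proj₁ = R₂

⊢-proj₂ : ∀ {A B} → (A · B) ⊢ B
⊢-proj₂ = ⊢-resp ·-comm ≈-refl R₂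

⊢-mp : ∀ {Γ A B} → Γ ⊢ A → Γ ⊢ (A ⇒g B) → Γ ⊢ B
⊢-mp ⊢A ⊢A⇒B = ⊢-trans (R₀ ⊢A ⊢A⇒B) MPᵢ

⊢-∨-elim : ∀ {Γ A B C} → Γ ⊢ (A ∨g B) → (Γ · A) ⊢ C → (Γ · B) ⊢ C → Γ ⊢ C
⊢-∨-elim ⊢A∨B A⊢C B⊢C =
  ⊢-mp ⊢-refl (⊢-trans ⊢A∨B (E∨ (R8ᵢ (swap A⊢C)) (R8ᵢ (swap B⊢C))))
  where
    swap : ∀ {X Y Z} → (X · Y) ⊢ Z → (Y · X) ⊢ Z
    swap = ⊢-resp ·-comm ≈-refl

⊢-excluded-middle : ∀ {Γ A} → Γ ⊢ (A ∨g cut A)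
⊢-excluded-middle = ⊢-trans (R8ᵢ ⊢-proj₂) (⊢-trans Ep I∨p)

⊢-explosion : ∀ {Γ A B} → Γ ⊢ A → Γ ⊢ cut A → Γ ⊢ B
⊢-explosion ⊢A ⊢¬A = ⊢-mp ⊢¬A (⊢-trans ⊢A (⊢-trans I∨ Ip3))

mainTheorem18 : (A B : Graph) → cut (A · cut B) ⊢ (A ⇒g B)
mainTheorem18 A B = R8ᵢ (⊢-∨-elim ⊢-excluded-middle ⊢-proj₂ (⊢-explosion ⊢-proj₂ ⊢¬¬B))
  where
    ⊢¬¬B : ((cut (A · cut B) · A) · cut B) ⊢ cut (cut B)
    ⊢¬¬B = ⊢-mp (⊢-trans ⊢-proj₁ ⊢-proj₂) (⊢-trans ⊢-proj₁ (⊢-trans ⊢-proj₁ Ip2))
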